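{- For every $n\ge 3$, $\gamma_{tR2}(C_n)=\left\lceil \frac{2n}{3}\right\rceil$, where $C_n$ is the cycle on $n$ vertices.
   Context: For a graph $G$ and $f:V(G)\to\{0,1,2\}$ let $V_i=\{v:f(v)=i\}$; $f$ is a total Roman $\{2\}$-dominating function (TR2DF) if every vertex $v$ with $f(v)=0$ has a neighbor $u$ with $f(u)=2$ or two distinct neighbors $x,y$ with $f(x)=f(y)=1$, and the subgraph induced by $V_1\cup V_2$ has no isolated vertices. $\gamma_{tR2}(G)$ is the minimum weight $\sum_v f(v)$ of a TR2DF of $G$. -}

module Defs where

open import Data.Nat using (ℕ; zero; suc; _+_; _*_; _≤_; _/_)
open import Data.Nat.DivMod using (_%_)
open import Data.Fin using (Fin; toℕ)
open import Data.Product using (Σ; ∃; _×_; _,_)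
open import Data.Sum using (_⊎_)
open import Relation.Binary.PropositionalEquality using (_≡_; _≢_)
open import Data.Vec.Functional using (Vector; foldr)

record Graph (n : ℕ) : Set₁ where
  field
    Adj : Fin n → Fin n → Set

open Graph public

-- The cycle C_n on vertices 0,…,n-1: i ~ j iff j ≡ i+1 (mod n) or i ≡ j+1 (mod n).
-- (For n ≥ 3 this is the simple n-cycle.)
cycleGraph : (n : ℕ) → Graph n
cycleGraph zero = record { Adj = λ _ _ → Fin 0 }
cycleGraph (suc m) = record
  { Adj = λ i j → (toℕ j ≡ suc (toℕ i) % suc m) ⊎ (toℕ i ≡ suc (toℕ j) % suc m) }

Labeling : ℕ → Set
Labeling n = Fin n → Fin 3

val : Fin 3 → ℕ
val f = toℕ f

weight : {n : ℕ} → Labeling n → ℕ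
weight f = foldr _+_ 0 (λ v → val (f v))

record IsTR2DF {n : ℕ} (G : Graph n) (f : Labeling n) : Set where
  field
    dom : ∀ v → val (f v) ≡ 0 →
          (∃ λ u → Adj G v u × val (f u) ≡ 2)
          ⊎ (∃ λ x → ∃ λ y → x ≢ y × Adj G v x × Adj G v y
                              × val (f x) ≡ 1 × val (f y) ≡ 1)
    total : ∀ v → val (f v) ≢ 0 → ∃ λ u → Adj G v u × val (f u) ≢ 0

IsTR2DNumber : {n : ℕ} → Graph n → ℕ → Set
IsTR2DNumber G k =
  (Σ (Labeling _) λ f → IsTR2DF G f × weight f ≡ k)
  × (∀ f → IsTR2DF G f → k ≤ weight f)

ceil3 : ℕ → ℕ
ceil3 m = (m + 2) / 3

{-# OPTIONS --safe #-}

-- Centre a window of three consecutive vertices at any vertex v of C_n. It weighs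
-- at least 2: if f v = 1, totality gives v a neighbour with positive label, and if
-- f v = 0, domination gives v a neighbour labelled 2 or two neighbours labelled 1.
-- The n windows cover every vertex three times, so 3 w(f) ≥ 2n. Conversely, the
-- labelling 1,1,0,1,1,0,… is a TR2DF of weight ⌈2n/3⌉.

module Submission where

open import Defs
open import Data.Nat.Base using (ℕ; zero; suc; _+_; _*_; _≤_; z≤n; s≤s)
open import Data.Nat.Properties
open import Data.Nat.DivMod using (_%_; _mod_; m%n<n; m<n⇒m%n≡m; n%n≡0; m<n*o⇒m/o<n; m/n≡1+[m∸n]/n)
open import Data.Fin.Base as Fin using (Fin; toℕ; inject₁; fromℕ)
open import Data.Fin.Properties using (toℕ-injective; toℕ<n; toℕ-fromℕ<; toℕ-fromℕ; toℕ-inject₁)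
open import Data.Vec.Functional using (Vector)
open import Algebra.Properties.CommutativeMonoid.Sum +-0-commutativeMonoid
  using (sum; sum-cong-≗; sum-init-last; ∑-distrib-+)
open import Data.Product using (∃; _×_; _,_)
open import Data.Sum using (_⊎_; inj₁; inj₂)
open import Data.Empty using (⊥-elim)
open import Data.Fin.Patterns using (0F; 1F)
open import Function.Base using (_∘_)
open import Relation.Binary.PropositionalEquality
open import Relation.Nullary using (yes; no)

n*c≤sum : ∀ {n} c (h : Vector ℕ n) → (∀ i → c ≤ h i) → n * c ≤ sum h
n*c≤sum {zero}  c h c≤h = z≤n
n*c≤sum {suc n} c h c≤h = +-mono-≤ (c≤h Fin.zero) (n*c≤sum c (h ∘ Fin.suc) (c≤h ∘ Fin.suc))

sum-toℕ-suc : ∀ (h : ℕ → ℕ) n → sum {suc n} (h ∘ toℕ) ≡ sum {n} (h ∘ toℕ) + h n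
sum-toℕ-suc h n = begin
  sum {suc n} (h ∘ toℕ)                              ≡⟨ sum-init-last (h ∘ toℕ) ⟩
  sum {n} (h ∘ toℕ ∘ inject₁) + h (toℕ (fromℕ n))   ≡⟨ cong₂ _+_ (sum-cong-≗ {n} (cong h ∘ toℕ-inject₁)) (cong h (toℕ-fromℕ n)) ⟩
  sum {n} (h ∘ toℕ) + h n                            ∎
  where open ≡-Reasoning

ceil3-≤ : ∀ {m k} → m ≤ 3 * k → ceil3 m ≤ k
ceil3-≤ {m} {k} m≤3k = ≤-pred (m<n*o⇒m/o<n (begin-strict
  m + 2      <⟨ +-monoʳ-< m (n<1+n 2) ⟩
  m + 3      ≤⟨ +-monoˡ-≤ 3 m≤3k ⟩
  3 * k + 3  ≡⟨ cong (_+ 3) (*-comm 3 k) ⟩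
  k * 3 + 3  ≡⟨ +-comm (k * 3) 3 ⟩
  suc k * 3  ∎))
  where open ≤-Reasoning

ceil3-3+ : ∀ m → ceil3 (3 + m) ≡ suc (ceil3 m)
ceil3-3+ m = m/n≡1+[m∸n]/n {3 + m + 2} {3} (s≤s (s≤s (s≤s z≤n)))

2≤m+n : ∀ m {n} → (m ≡ 0 → 2 ≤ n) → (m ≢ 0 → 1 ≤ n) → 2 ≤ m + n
2≤m+n zero          m≡0⇒2≤n _       = m≡0⇒2≤n refl
2≤m+n (suc zero)    _       m≢0⇒1≤n = s≤s (m≢0⇒1≤n 1+n≢0)
2≤m+n (suc (suc m)) _       _       = s≤s (s≤s z≤n)

module Cycle (m : ℕ) where

  private
    N : ℕ
    N = suc m

  C : Graph N
  C = cycleGraph N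

  next : Fin N → Fin N
  next i = suc (toℕ i) mod N

  toℕ-next : ∀ i → toℕ (next i) ≡ suc (toℕ i) % N
  toℕ-next i = toℕ-fromℕ< (m%n<n (suc (toℕ i)) N)

  toℕ-next-cases : ∀ i → toℕ (next i) ≡ suc (toℕ i) ⊎ (toℕ (next i) ≡ 0 × suc (toℕ i) ≡ N)
  toℕ-next-cases i with suc (toℕ i) <? N
  ... | yes 1+i<N = inj₁ (trans (toℕ-next i) (m<n⇒m%n≡m 1+i<N))
  ... | no  1+i≮N = inj₂ (trans (toℕ-next i) (trans (cong (_% N) 1+i≡N) (n%n≡0 N)) , 1+i≡N)
    where 1+i≡N = ≤-antisym (toℕ<n i) (≮⇒≥ 1+i≮N)

  next-injective : ∀ {i j} → next i ≡ next j → i ≡ j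
  next-injective {i} {j} eq with toℕ-next-cases i | toℕ-next-cases j
  ... | inj₁ ei       | inj₁ ej       = toℕ-injective (suc-injective (trans (sym ei) (trans (cong toℕ eq) ej)))
  ... | inj₁ ei       | inj₂ (ej , _) with () ← trans (sym ei) (trans (cong toℕ eq) ej)
  ... | inj₂ (ei , _) | inj₁ ej       with () ← trans (sym ej) (trans (cong toℕ (sym eq)) ei)
  ... | inj₂ (_ , ei) | inj₂ (_ , ej) = toℕ-injective (suc-injective (trans ei (sym ej)))

  next-inject₁ : ∀ (i : Fin m) → next (inject₁ i) ≡ Fin.suc i
  next-inject₁ i = toℕ-injective (begin
    toℕ (next (inject₁ i))      ≡⟨ toℕ-next (inject₁ i) ⟩
    suc (toℕ (inject₁ i)) % N   ≡⟨ cong (λ k → suc k % N) (toℕ-inject₁ i) ⟩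
    suc (toℕ i) % N             ≡⟨ m<n⇒m%n≡m (s≤s (toℕ<n i)) ⟩
    suc (toℕ i)                 ∎)
    where open ≡-Reasoning

  next-fromℕ : next (fromℕ m) ≡ Fin.zero
  next-fromℕ = toℕ-injective (trans (toℕ-next (fromℕ m))
    (trans (cong (λ k → suc k % N) (toℕ-fromℕ m)) (n%n≡0 N)))

  sum-∘-next : ∀ (h : Vector ℕ N) → sum (h ∘ next) ≡ sum h
  sum-∘-next h = begin
    sum (h ∘ next)                               ≡⟨ sum-init-last (h ∘ next) ⟩
    sum (h ∘ next ∘ inject₁) + h (next (fromℕ m)) ≡⟨ cong₂ _+_ (sum-cong-≗ (cong h ∘ next-inject₁)) (cong h next-fromℕ) ⟩
    sum (h ∘ Fin.suc) + h Fin.zero               ≡⟨ +-comm _ (h Fin.zero) ⟩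
    sum h                                        ∎
    where open ≡-Reasoning

  adj-next : ∀ i → Adj C i (next i)
  adj-next i = inj₁ (toℕ-next i)

  next-adj : ∀ i → Adj C (next i) i
  next-adj i = inj₂ (toℕ-next i)

  adj⇒next : ∀ {i j} → Adj C i j → j ≡ next i ⊎ i ≡ next j
  adj⇒next {i} {j} (inj₁ e) = inj₁ (toℕ-injective (trans e (sym (toℕ-next i))))
  adj⇒next {i} {j} (inj₂ e) = inj₂ (toℕ-injective (trans e (sym (toℕ-next j))))

  neighbours-of-next : ∀ {i j} → Adj C (next i) j → j ≡ i ⊎ j ≡ next (next i)
  neighbours-of-next adj with adj⇒next adj
  ... | inj₁ j≡next² = inj₂ j≡next²
  ... | inj₂ eq      = inj₁ (next-injective (sym eq))

  predecessor : ∀ i {k} → toℕ i ≡ suc k → ∃ λ j → next j ≡ i × toℕ j ≡ k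
  predecessor (Fin.suc i) eq = inject₁ i , next-inject₁ i , trans (toℕ-inject₁ i) (suc-injective eq)

  sum-window : ∀ (h : Vector ℕ N) → sum (λ i → h (next i) + (h i + h (next (next i)))) ≡ 3 * sum h
  sum-window h = begin
    sum (λ i → h (next i) + (h i + h (next (next i))))
      ≡⟨ ∑-distrib-+ (h ∘ next) (λ i → h i + h (next (next i))) ⟩
    sum (h ∘ next) + sum (λ i → h i + h (next (next i)))
      ≡⟨ cong (sum (h ∘ next) +_) (∑-distrib-+ h (h ∘ next ∘ next)) ⟩
    sum (h ∘ next) + (sum h + sum (h ∘ next ∘ next))
      ≡⟨ cong₂ (λ x y → x + (sum h + y)) (sum-∘-next h) (trans (sum-∘-next (h ∘ next)) (sum-∘-next h)) ⟩
    sum h + (sum h + sum h)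
      ≡⟨ cong (λ x → sum h + (sum h + x)) (sym (+-identityʳ (sum h))) ⟩
    3 * sum h
      ∎
    where open ≡-Reasoning

module _ {m : ℕ} {f : Labeling (suc m)} (isTR2DF : IsTR2DF (cycleGraph (suc m)) f) where
  open Cycle m
  open IsTR2DF isTR2DF

  private
    w : Vector ℕ (suc m)
    w v = val (f v)

  next-zero⇒2≤neighbours : ∀ v → w (next v) ≡ 0 → 2 ≤ w v + w (next (next v))
  next-zero⇒2≤neighbours v z with dom (next v) z
  ... | inj₁ (u , adj , u≡2) with neighbours-of-next adj
  ...   | inj₁ refl = ≤-trans (≤-reflexive (sym u≡2)) (m≤m+n _ _)
  ...   | inj₂ refl = ≤-trans (≤-reflexive (sym u≡2)) (m≤n+m _ _)
  next-zero⇒2≤neighbours v z | inj₂ (x , y , x≢y , adj-x , adj-y , x≡1 , y≡1)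
    with neighbours-of-next adj-x | neighbours-of-next adj-y
  ... | inj₁ refl | inj₁ refl = ⊥-elim (x≢y refl)
  ... | inj₁ refl | inj₂ refl = ≤-reflexive (sym (cong₂ _+_ x≡1 y≡1))
  ... | inj₂ refl | inj₁ refl = ≤-reflexive (sym (cong₂ _+_ y≡1 x≡1))
  ... | inj₂ refl | inj₂ refl = ⊥-elim (x≢y refl)

  next-nonzero⇒1≤neighbours : ∀ v → w (next v) ≢ 0 → 1 ≤ w v + w (next (next v))
  next-nonzero⇒1≤neighbours v nz with total (next v) nz
  ... | u , adj , u≢0 with neighbours-of-next adj
  ...   | inj₁ refl = ≤-trans (n≢0⇒n>0 u≢0) (m≤m+n _ _)
  ...   | inj₂ refl = ≤-trans (n≢0⇒n>0 u≢0) (m≤n+m _ _)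

  ceil3-≤-weight : ceil3 (2 * suc m) ≤ weight f
  ceil3-≤-weight = ceil3-≤ (begin
    2 * suc m                                            ≡⟨ *-comm 2 (suc m) ⟩
    suc m * 2                                            ≤⟨ n*c≤sum 2 window window-≥2 ⟩
    sum window                                           ≡⟨ sum-window w ⟩
    3 * weight f                                         ∎)
    where
    open ≤-Reasoning
    window : Vector ℕ (suc m)
    window v = w (next v) + (w v + w (next (next v)))
    window-≥2 : ∀ v → 2 ≤ window v
    window-≥2 v = 2≤m+n (w (next v)) (next-zero⇒2≤neighbours v) (next-nonzero⇒1≤neighbours v)

label110 : ℕ → Fin 3
label110 0                   = 1F
label110 1                   = 1F
label110 2                   = 0F
label110 (suc (suc (suc i))) = label110 i

label110-window : ∀ i → val (label110 i) + val (label110 (1 + i)) + val (label110 (2 + i)) ≡ 2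
label110-window 0                   = refl
label110-window 1                   = refl
label110-window 2                   = refl
label110-window (suc (suc (suc i))) = label110-window i

label110-zero : ∀ i → val (label110 i) ≡ 0 →
                ∃ λ k → i ≡ 2 + k × val (label110 (1 + k)) ≡ 1 × val (label110 (3 + k)) ≡ 1
label110-zero 2 _ = 0 , refl , refl , refl
label110-zero (suc (suc (suc i))) z with label110-zero i z
... | k , refl , l1 , l3 = 3 + k , refl , l1 , l3

label110-nonzero : ∀ i → val (label110 i) ≢ 0 →
                   val (label110 (1 + i)) ≡ 1 ⊎ ∃ λ k → i ≡ 1 + k × val (label110 k) ≡ 1
label110-nonzero 0 _  = inj₁ refl
label110-nonzero 1 _  = inj₂ (0 , refl , refl)
label110-nonzero 2 nz = ⊥-elim (nz refl)
label110-nonzero (suc (suc (suc i))) nz with label110-nonzero i nz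
... | inj₁ l1              = inj₁ l1
... | inj₂ (k , refl , l1) = inj₂ (3 + k , refl , l1)

sum-label110 : ∀ n → sum {n} (val ∘ label110 ∘ toℕ) ≡ ceil3 (2 * n)
sum-label110 0 = refl
sum-label110 1 = refl
sum-label110 2 = refl
sum-label110 (suc (suc (suc n))) = begin
  sum {3 + n} (l ∘ toℕ)
    ≡⟨ sum-toℕ-suc l (2 + n) ⟩
  sum {2 + n} (l ∘ toℕ) + l (2 + n)
    ≡⟨ cong (_+ l (2 + n)) (sum-toℕ-suc l (1 + n)) ⟩
  sum {1 + n} (l ∘ toℕ) + l (1 + n) + l (2 + n)
    ≡⟨ cong (λ x → x + l (1 + n) + l (2 + n)) (sum-toℕ-suc l n) ⟩
  S + l n + l (1 + n) + l (2 + n)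
    ≡⟨ trans (cong (_+ l (2 + n)) (+-assoc S (l n) (l (1 + n)))) (+-assoc S _ (l (2 + n))) ⟩
  S + (l n + l (1 + n) + l (2 + n))
    ≡⟨ cong (S +_) (label110-window n) ⟩
  S + 2
    ≡⟨ trans (cong (_+ 2) (sum-label110 n)) (+-comm _ 2) ⟩
  2 + ceil3 (2 * n)
    ≡⟨ sym (trans (ceil3-3+ (3 + 2 * n)) (cong suc (ceil3-3+ (2 * n)))) ⟩
  ceil3 (6 + 2 * n)
    ≡⟨ cong ceil3 (sym (*-distribˡ-+ 2 3 n)) ⟩
  ceil3 (2 * (3 + n))
    ∎
  where
  open ≡-Reasoning
  l : ℕ → ℕ
  l = val ∘ label110
  S : ℕ
  S = sum {n} (l ∘ toℕ)

module _ (m : ℕ) where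
  open Cycle m

  cycleLabel110 : Labeling (suc m)
  cycleLabel110 v = label110 (toℕ v)

  -- Past the last vertex the labelling wraps around to vertex 0, which is labelled 1.
  cycleLabel110-next : ∀ v → val (label110 (suc (toℕ v))) ≡ 1 → val (cycleLabel110 (next v)) ≡ 1
  cycleLabel110-next v l≡1 with toℕ-next-cases v
  ... | inj₁ e       = trans (cong (val ∘ label110) e) l≡1
  ... | inj₂ (e , _) = cong (val ∘ label110) e

  cycleLabel110-isTR2DF : IsTR2DF C cycleLabel110
  IsTR2DF.dom cycleLabel110-isTR2DF v z with label110-zero (toℕ v) z
  ... | k , v≡2+k , l1 , l3 with predecessor v v≡2+k
  ...   | u , refl , u≡1+k =
    inj₂ (u , next v , u≢next-v , next-adj u , adj-next v ,
          trans (cong (val ∘ label110) u≡1+k) l1 ,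
          cycleLabel110-next v (trans (cong (val ∘ label110 ∘ suc) v≡2+k) l3))
    where
    u≢next-v : u ≢ next v
    u≢next-v u≡next-v with toℕ-next-cases v
    ... | inj₁ e       = m≢1+n+m (1 + k) {1} (trans (sym u≡1+k) (trans (cong toℕ u≡next-v) (trans e (cong suc v≡2+k))))
    ... | inj₂ (e , _) = 1+n≢0 (trans (sym u≡1+k) (trans (cong toℕ u≡next-v) e))
  IsTR2DF.total cycleLabel110-isTR2DF v nz with label110-nonzero (toℕ v) nz
  ... | inj₁ l1 = next v , adj-next v , λ z → 0≢1+n (trans (sym z) (cycleLabel110-next v l1))
  ... | inj₂ (k , v≡1+k , l1) with predecessor v v≡1+k
  ...   | u , refl , u≡k = u , next-adj u , λ z → 0≢1+n (trans (sym z) (trans (cong (val ∘ label110) u≡k) l1))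

mainTheorem9 : (n : ℕ) → 3 ≤ n → IsTR2DNumber (cycleGraph n) (ceil3 (2 * n))
mainTheorem9 (suc m) _ =
  (cycleLabel110 m , cycleLabel110-isTR2DF m , sum-label110 (suc m)) ,
  λ f isTR2DF → ceil3-≤-weight isTR2DF
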